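{- Let $p,q$ be colored words with $m(p)=m(q)$. Then $I_i(p)=I_i(q)$ for all $i\in\mathbb{Z}$.
   Context: Colored integers $i^{[j]}$ (value $\mathrm{val}(i^{[j]})=i\in\mathbb{Z}$, color $j\in\mathbb{Z}_{>0}$) are totally ordered by value then color; integers are identified with color-1 colored integers. For a colored word $t=(t_1,\dots,t_k)$, $m(t)\in\mathbb{Z}^k$ is defined by $m(t)_k=\mathrm{val}(t_k)$ and for $j<k$: $m(t)_j=m(t)_{j+1}$ if $t_j\ge t_{j+1}$, $m(t)_j=\min(\mathrm{val}(t_j),m(t)_{j+1}-1)$ if $t_j<t_{j+1}$. For a (colored or integer) word $p=(p_1,\dots,p_k)$, $I(p)$ is the length of the longest strictly increasing suffix of $p$ (0 for the empty word), and $I_i(p)=I(p)$ if $k\ge1$ and $\mathrm{val}(p_k)\le i$, $I_i(p)=0$ otherwise. -}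

module Defs where

open import Data.Nat as ℕ using (ℕ; zero; suc)
open import Data.Integer as ℤ using (ℤ; _-_; _⊓_; +_)
open import Data.Product using (_×_; _,_)
open import Data.Sum using (_⊎_)
open import Data.List using (List; []; _∷_; reverse)
open import Relation.Binary.PropositionalEquality using (_≡_)
open import Relation.Nullary using (Dec; yes; no; ¬_)
open import Relation.Nullary.Decidable using (_⊎-dec_; _×-dec_)

record CInt : Set where
  constructor _^[_]
  field
    val : ℤ
    color : ℕ
    .{{color-pos}} : ℕ.NonZero color
open CInt public

fromℤ : ℤ → CInt
fromℤ i = i ^[ 1 ]

_<ᶜ_ : CInt → CInt → Set
a <ᶜ b = (val a ℤ.< val b) ⊎ ((val a ≡ val b) × (color a ℕ.< color b))

_<ᶜ?_ : (a b : CInt) → Dec (a <ᶜ b)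
a <ᶜ? b = (val a ℤ.<? val b) ⊎-dec ((val a ℤ.≟ val b) ×-dec (color a ℕ.<? color b))

CWord : Set
CWord = List CInt

-- For t = t_j ∷ rest with rest nonempty, m_j = m_{j+1} if t_j ≥ t_{j+1}
-- (i.e. not t_j < t_{j+1}, the order being total), and
-- m_j = min(val t_j, m_{j+1} - 1) if t_j < t_{j+1}.
m : CWord → List ℤ
m [] = []
m (t ∷ []) = val t ∷ []
m (t ∷ t' ∷ ts) with m (t' ∷ ts)
... | [] = []   -- unreachable: m of a nonempty word is nonempty
... | μ ∷ μs with t <ᶜ? t'
...   | yes _ = (val t ⊓ (μ - + 1)) ∷ μ ∷ μs
...   | no  _ = μ ∷ μ ∷ μs

-- I(p): length of the longest strictly increasing suffix of p.
-- Computed on the reversed word: the length of the longest prefix of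
-- rev p = (p_k, p_{k-1}, ...) that is strictly decreasing.
-- decRun x ys: length of the longest strictly decreasing prefix of x ∷ ys.
decRun : CInt → CWord → ℕ
decRun x [] = 1
decRun x (y ∷ ys) with y <ᶜ? x
... | yes _ = suc (decRun y ys)
... | no  _ = 1

incRev : CWord → ℕ
incRev [] = 0
incRev (x ∷ xs) = decRun x xs

I : CWord → ℕ
I p = incRev (reverse p)

Iᵢ : ℤ → CWord → ℕ
Iᵢ i p with reverse p
... | [] = 0
... | x ∷ _ with val x ℤ.≤? i
...   | yes _ = I p
...   | no  _ = 0

{-# OPTIONS --safe #-}
module Submission where

-- Entry j of m(p) is smaller than entry j+1 exactly when p_j < p_{j+1}, and the last entry of m(p)
-- is val(p_k). Since I_i(p) only sees the relative order of neighbouring letters of p together with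
-- val(p_k), two words with the same m agree on every I_i.

open import Defs
open import Data.Integer using (ℤ)
open import Data.List using (List)
open import Relation.Binary.PropositionalEquality using (_≡_)

open import Level using (_⊔_)
open import Data.Nat using (suc)
import Data.Integer as ℤ
import Data.Integer.Properties as ℤ
open import Data.List using ([]; _∷_; [_]; reverse; _ʳ++_; head; last)
import Data.Maybe as Maybe
open import Data.Maybe.Properties using (just-injective)
open import Function using (flip; const)
open import Function.Bundles using (_⇔_; mk⇔; Equivalence)
import Function.Properties.Equivalence as ⇔
open import Relation.Binary.Core using (Rel)
open import Relation.Binary.PropositionalEquality using (refl; sym; cong; subst; module ≡-Reasoning)
open import Relation.Nullary using (yes; no; contradiction)

module _ {a b r s} {A : Set a} {B : Set b} (R : Rel A r) (S : Rel B s) where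

  data SameAscents : List A → List B → Set (a ⊔ b ⊔ r ⊔ s) where
    []  : SameAscents [] []
    [-] : ∀ {x y} → SameAscents [ x ] [ y ]
    _∷_ : ∀ {x x′ xs y y′ ys} → (R x x′ ⇔ S y y′) →
          SameAscents (x′ ∷ xs) (y′ ∷ ys) → SameAscents (x ∷ x′ ∷ xs) (y ∷ y′ ∷ ys)

module _ {a b r s} {A : Set a} {B : Set b} {R : Rel A r} {S : Rel B s} where

  sameAscents-sym : ∀ {xs ys} → SameAscents R S xs ys → SameAscents S R ys xs
  sameAscents-sym []         = []
  sameAscents-sym [-]        = [-]
  sameAscents-sym (x⇔y ∷ as) = ⇔.sym x⇔y ∷ sameAscents-sym as

  sameAscents-ʳ++ : ∀ {x xs acc y ys acc′} →
    SameAscents R S (x ∷ xs) (y ∷ ys) →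
    SameAscents (flip R) (flip S) (x ∷ acc) (y ∷ acc′) →
    SameAscents (flip R) (flip S) (xs ʳ++ x ∷ acc) (ys ʳ++ y ∷ acc′)
  sameAscents-ʳ++ [-]        bs = bs
  sameAscents-ʳ++ (x⇔y ∷ as) bs = sameAscents-ʳ++ as (x⇔y ∷ bs)

  sameAscents-reverse : ∀ {xs ys} →
    SameAscents R S xs ys → SameAscents (flip R) (flip S) (reverse xs) (reverse ys)
  sameAscents-reverse []         = []
  sameAscents-reverse [-]        = [-]
  sameAscents-reverse as@(_ ∷ _) = sameAscents-ʳ++ as [-]

module _ {a b c r s t} {A : Set a} {B : Set b} {C : Set c}
         {R : Rel A r} {S : Rel B s} {T : Rel C t} where

  sameAscents-trans : ∀ {xs ys zs} →
    SameAscents R S xs ys → SameAscents S T ys zs → SameAscents R T xs zs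
  sameAscents-trans []         []         = []
  sameAscents-trans [-]        [-]        = [-]
  sameAscents-trans (x⇔y ∷ as) (y⇔z ∷ bs) = ⇔.trans x⇔y y⇔z ∷ sameAscents-trans as bs

head-ʳ++ : ∀ {a} {A : Set a} (x : A) xs acc → head (xs ʳ++ x ∷ acc) ≡ last (x ∷ xs)
head-ʳ++ x []        acc = refl
head-ʳ++ x (x′ ∷ xs) acc = head-ʳ++ x′ xs (x ∷ acc)

head-reverse : ∀ {a} {A : Set a} (xs : List A) → head (reverse xs) ≡ last xs
head-reverse []       = refl
head-reverse (x ∷ xs) = head-ʳ++ x xs []

i⊓[j-1]<j : ∀ i j → i ℤ.⊓ (j ℤ.- ℤ.+ 1) ℤ.< j
i⊓[j-1]<j i j =
  ℤ.i≤pred[j]⇒i<j (ℤ.≤-trans (ℤ.i⊓j≤j i (j ℤ.- ℤ.+ 1)) (ℤ.≤-reflexive (ℤ.+-comm j ℤ.-1ℤ)))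

m-sameAscents : ∀ p → SameAscents _<ᶜ_ ℤ._<_ p (m p)
m-sameAscents []           = []
m-sameAscents (t ∷ [])     = [-]
m-sameAscents (t ∷ t′ ∷ ts) with m (t′ ∷ ts) | m-sameAscents (t′ ∷ ts)
... | μ ∷ μs | as with t <ᶜ? t′
...   | yes t<t′ = mk⇔ (const (i⊓[j-1]<j (val t) μ)) (const t<t′) ∷ as
...   | no  t≮t′ = mk⇔ (flip contradiction t≮t′) (flip contradiction (ℤ.<-irrefl refl)) ∷ as

last-m : ∀ p → last (m p) ≡ Maybe.map val (last p)
last-m []            = refl
last-m (t ∷ [])      = refl
-- m-sameAscents only serves to rule out m (t′ ∷ ts) ≡ [].
last-m (t ∷ t′ ∷ ts) with m (t′ ∷ ts) | m-sameAscents (t′ ∷ ts) | last-m (t′ ∷ ts)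
... | μ ∷ μs | _ | eq with t <ᶜ? t′
...   | yes _ = eq
...   | no  _ = eq

incRev-cong : ∀ {xs ys} → SameAscents (flip _<ᶜ_) (flip _<ᶜ_) xs ys → incRev xs ≡ incRev ys
incRev-cong [] = refl
incRev-cong [-] = refl
incRev-cong {x ∷ x′ ∷ xs} {y ∷ y′ ∷ ys} (x⇔y ∷ as) with x′ <ᶜ? x | y′ <ᶜ? y
... | yes _     | yes _     = cong suc (incRev-cong as)
... | yes x′<x  | no  y′≮y  = contradiction (Equivalence.to x⇔y x′<x) y′≮y
... | no  x′≮x  | yes y′<y  = contradiction (Equivalence.from x⇔y y′<y) x′≮x
... | no  _     | no  _     = refl

I-cong : ∀ {p q} → SameAscents _<ᶜ_ _<ᶜ_ p q → I p ≡ I q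
I-cong as = incRev-cong (sameAscents-reverse as)

Iᵢ-cong : ∀ i {p q} → SameAscents _<ᶜ_ _<ᶜ_ p q →
          Maybe.map val (last p) ≡ Maybe.map val (last q) → Iᵢ i p ≡ Iᵢ i q
Iᵢ-cong i {p} {q} as lastp≡lastq with reverse p | reverse q | headVal≡
  where
  headVal≡ : Maybe.map val (head (reverse p)) ≡ Maybe.map val (head (reverse q))
  headVal≡ = begin
    Maybe.map val (head (reverse p)) ≡⟨ cong (Maybe.map val) (head-reverse p) ⟩
    Maybe.map val (last p)           ≡⟨ lastp≡lastq ⟩
    Maybe.map val (last q)           ≡⟨ cong (Maybe.map val) (head-reverse q) ⟨
    Maybe.map val (head (reverse q)) ∎
    where open ≡-Reasoning
-- When exactly one of the reversed words is empty, headVal≡ has the absurd type nothing ≡ just _.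
... | []    | []    | _  = refl
... | x ∷ _ | y ∷ _ | vx≡vy with val x ℤ.≤? i | val y ℤ.≤? i
...   | yes _   | yes _   = I-cong as
...   | yes x≤i | no  y≰i = contradiction (subst (ℤ._≤ i) (just-injective vx≡vy) x≤i) y≰i
...   | no  x≰i | yes y≤i = contradiction (subst (ℤ._≤ i) (just-injective (sym vx≡vy)) y≤i) x≰i
...   | no  _   | no  _   = refl

proposition5p4 : (p q : CWord) → m p ≡ m q → (i : ℤ) → Iᵢ i p ≡ Iᵢ i q
proposition5p4 p q mp≡mq i = Iᵢ-cong i p∼q lastp≡lastq
  where
  p∼q : SameAscents _<ᶜ_ _<ᶜ_ p q
  p∼q = sameAscents-trans (subst (SameAscents _<ᶜ_ ℤ._<_ p) mp≡mq (m-sameAscents p))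
                          (sameAscents-sym (m-sameAscents q))

  lastp≡lastq : Maybe.map val (last p) ≡ Maybe.map val (last q)
  lastp≡lastq = begin
    Maybe.map val (last p) ≡⟨ last-m p ⟨
    last (m p)             ≡⟨ cong last mp≡mq ⟩
    last (m q)             ≡⟨ last-m q ⟩
    Maybe.map val (last q) ∎
    where open ≡-Reasoning
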